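{- Let $T$ be a tree with at least two vertices, and let $w$ be a word of minimum length $\ell(T)$ that word-represents $T$. Let $x,y$ be two distinct vertices of $T$ each occurring exactly once in $w$ (such vertices alternate in $w$, so $xy$ is an edge of $T$), labeled so that $x$ occurs before $y$ in $w$. Then $w=w_{x_1}w_{x_2}\cdots w_{x_m}\,w_{y_1}w_{y_2}\cdots w_{y_n}$ where every letter $w_{x_i}$ is a vertex of $T_{x,xy}$ and every letter $w_{y_j}$ is a vertex of $T_{y,xy}$; i.e. every occurrence of a vertex of $T_{x,xy}$ in $w$ lies to the left of every occurrence of a vertex of $T_{y,xy}$.
   Context: A word $w$ over the alphabet $V$ word-represents a graph $G=(V,E)$ if $w$ contains every letter of $V$ at least once and for all distinct $u,v\in V$, $uv\in E$ if and only if $u$ and $v$ alternate in $w$ (the subword of $w$ consisting only of occurrences of $u$ and $v$ has no two equal consecutive letters). $\ell(G)$ is the minimum length of a word that word-represents $G$. For a tree $T$ and an edge $xy$ of $T$, $T_{x,xy}$ denotes the connected component containing $x$ of the graph obtained from $T$ by deleting the edge $xy$; $T_{y,xy}$ is defined similarly. -}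

module Defs where

open import Data.Nat using (ℕ; _≤_; _<_; suc)
open import Data.Fin using (Fin)
open import Data.List using (List; []; _∷_; filter; length; lookup)
open import Data.List.Membership.Propositional using (_∈_)
open import Data.Product using (_×_; Σ; ∃; _,_)
open import Data.Sum using (_⊎_)
open import Relation.Nullary using (¬_; Dec)
open import Relation.Binary.PropositionalEquality using (_≡_; _≢_)
open import Data.Fin.Properties using (_≟_)
open import Relation.Nullary.Decidable using (_⊎-dec_)
open import Function.Bundles using (_⇔_)

record Graph (n : ℕ) : Set₁ where
  field
    Adj   : Fin n → Fin n → Set
    sym   : ∀ {u v} → Adj u v → Adj v u
    irrefl : ∀ {u} → ¬ Adj u u
open Graph public

SameEdge : ∀ {n} → Fin n → Fin n → Fin n → Fin n → Set
SameEdge u v a b = (u ≡ a × v ≡ b) ⊎ (u ≡ b × v ≡ a)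

data WalkAvoiding {n : ℕ} (G : Graph n) (a b : Fin n) : Fin n → Fin n → Set where
  here : ∀ {u} → WalkAvoiding G a b u u
  step : ∀ {u v w} → Adj G u v → ¬ SameEdge u v a b →
         WalkAvoiding G a b v w → WalkAvoiding G a b u w

data Walk {n : ℕ} (G : Graph n) : Fin n → Fin n → Set where
  here : ∀ {u} → Walk G u u
  step : ∀ {u v w} → Adj G u v → Walk G v w → Walk G u w

Connected : ∀ {n} → Graph n → Set
Connected G = ∀ u v → Walk G u v

IsTree : ∀ {n} → Graph n → Set
IsTree G = Connected G × (∀ a b → Adj G a b → ¬ WalkAvoiding G a b a b)

-- Vertex z lies in T_{x,xy}: the component containing x of T - xy.
InComponent : ∀ {n} → Graph n → Fin n → Fin n → Fin n → Set
InComponent G x y z = WalkAvoiding G x y x z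

Word : ℕ → Set
Word n = List (Fin n)

restrict : ∀ {n} → Fin n → Fin n → Word n → Word n
restrict u v = filter (λ z → (z ≟ u) ⊎-dec (z ≟ v))

data NoRepeat {n : ℕ} : Word n → Set where
  nil  : NoRepeat []
  one  : ∀ {a} → NoRepeat (a ∷ [])
  cons : ∀ {a b w} → a ≢ b → NoRepeat (b ∷ w) → NoRepeat (a ∷ b ∷ w)

Alternate : ∀ {n} → Word n → Fin n → Fin n → Set
Alternate w u v = NoRepeat (restrict u v w)

Represents : ∀ {n} → Word n → Graph n → Set
Represents w G =
  (∀ v → v ∈ w) ×
  (∀ u v → u ≢ v → (Adj G u v ⇔ Alternate w u v))

MinRepresents : ∀ {n} → Word n → Graph n → Set
MinRepresents w G =
  Represents w G × (∀ (w' : Word _) → Represents w' G → length w ≤ length w')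

occ : ∀ {n} → Fin n → Word n → ℕ
occ x w = length (filter (_≟ x) w)

-- Idea.  x and y occurring once alternate, so xy is an edge.  Any other
-- vertex occurs at least twice (once would make it adjacent to both x and
-- y) and at most twice (every tree has a representing word with all
-- vertices at most twice and x, y once — `TreeWord` — which would be
-- shorter).  So every vertex z has a span [first z, last z].  In such a
-- word two non-adjacent vertices have non-crossing spans (disjoint or
-- nested), while a neighbour of z occurs inside the span of z.  Walking
-- along paths to x and to y this gives, for u on the x-side and v on the
-- y-side: v is never nested in the span of u ≠ x (`B-not-inside-A`),
-- x precedes v (`x-before-B`), and finally u precedes v (`A-before-B`).
module Submission where

open import Defs hiding (sym)
open import Data.Nat using (ℕ; zero; suc; _+_; _≤_; _<_; z≤n; s≤s; _≤?_)
open import Data.Nat.Properties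
  using ( +-0-commutativeMonoid; +-mono-≤; +-mono-<-≤; +-mono-≤-<; suc-injective
        ; ≤-refl; ≤-trans; ≤-pred; ≤-antisym; <-trans; <-irrefl; <-asym; <-cmp
        ; <-≤-trans; ≤-<-trans; ≰⇒>; m≤n+m; m≤n⇒m<n∨m≡n; module ≤-Reasoning)
open import Data.Fin using (Fin; toℕ; zero; suc; punchIn)
open import Data.Fin.Properties using (_≟_; punchInᵢ≢i)
open import Data.List using (List; []; _∷_; length; lookup; filter; _++_; allFin)
open import Data.List.Properties
  using (filter-accept; filter-reject; filter-++; filter-none; filter-≐; length-++; length-filter)
open import Data.List.Relation.Unary.All using (tabulate)
open import Data.List.Relation.Unary.Any using (here; there)
open import Data.List.Membership.Propositional using (_∈_; _∉_)
open import Data.List.Membership.Propositional.Properties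
  using (∈-++⁺ˡ; ∈-++⁺ʳ; ∈-++⁻; ∈-allFin; ∈-filter⁻)
open import Data.List.Membership.DecPropositional using () renaming (_∈?_ to member?)
open import Data.Product using (Σ; _×_; _,_; proj₁; proj₂)
open import Data.Sum using (_⊎_; inj₁; inj₂)
import Data.Sum
open import Data.Empty using (⊥; ⊥-elim)
open import Function using (_∘′_)
open import Function.Bundles using (_⇔_; mk⇔; Equivalence)
open import Relation.Nullary using (¬_; Dec; yes; no)
open import Relation.Nullary.Decidable using (_⊎-dec_)
open import Relation.Unary using (Decidable)
open import Relation.Binary.Definitions using (tri<; tri≈; tri>)
open import Relation.Binary.PropositionalEquality
  using (_≡_; _≢_; refl; sym; trans; cong; cong₂; subst; subst₂; module ≡-Reasoning)

private
  variable
    n : ℕ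

data At {n : ℕ} : Word n → ℕ → Fin n → Set where
  at-head : ∀ {a w} → At (a ∷ w) 0 a
  at-tail : ∀ {a b w k} → At w k b → At (a ∷ w) (suc k) b

At-functional : ∀ {w : Word n} {k a b} → At w k a → At w k b → a ≡ b
At-functional at-head     at-head     = refl
At-functional (at-tail p) (at-tail q) = At-functional p q

At-lookup : (w : Word n) (i : Fin (length w)) → At w (toℕ i) (lookup w i)
At-lookup (a ∷ w) zero    = at-head
At-lookup (a ∷ w) (suc i) = at-tail (At-lookup w i)

At⇒lookup : ∀ {w : Word n} {k a} → At w k a → Σ (Fin (length w)) λ i → toℕ i ≡ k × lookup w i ≡ a
At⇒lookup at-head      = zero , refl , refl
At⇒lookup (at-tail at) = let i , i≡k , w[i]≡a = At⇒lookup at in suc i , cong suc i≡k , w[i]≡a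

∈⇒At : ∀ {w : Word n} {a} → a ∈ w → Σ ℕ λ k → At w k a
∈⇒At (here refl) = 0 , at-head
∈⇒At (there a∈w) = let k , at = ∈⇒At a∈w in suc k , at-tail at

-- `Span w a f l`: the letter a occurs in w exactly at the positions f ≤ l
-- (once if f ≡ l, twice if f < l).
record Span (w : Word n) (a : Fin n) (f l : ℕ) : Set where
  field
    ordered  : f ≤ l
    at-first : At w f a
    at-last  : At w l a
    only     : ∀ {k} → At w k a → k ≡ f ⊎ k ≡ l

module _ {w : Word n} {a : Fin n} {f l : ℕ} (s : Span w a f l) where
  open Span s

  span-bounds : ∀ {k} → At w k a → f ≤ k × k ≤ l
  span-bounds at with only at
  ... | inj₁ refl = ≤-refl , ordered
  ... | inj₂ refl = ordered , ≤-refl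

  span-pair : ∀ {i j} → At w i a → At w j a → i < j → i ≡ f × j ≡ l
  span-pair at-i at-j i<j with only at-i | only at-j
  ... | inj₁ refl | inj₁ refl = ⊥-elim (<-irrefl refl i<j)
  ... | inj₁ refl | inj₂ refl = refl , refl
  ... | inj₂ refl | inj₁ refl = ⊥-elim (<-irrefl refl (<-≤-trans i<j ordered))
  ... | inj₂ refl | inj₂ refl = ⊥-elim (<-irrefl refl i<j)

span-unique : ∀ {w : Word n} {a f l f′ l′} → Span w a f l → Span w a f′ l′ → f ≡ f′ × l ≡ l′
span-unique s s′ =
    ≤-antisym (proj₁ (span-bounds s (Span.at-first s′))) (proj₁ (span-bounds s′ (Span.at-first s)))
  , ≤-antisym (proj₂ (span-bounds s′ (Span.at-last s))) (proj₂ (span-bounds s (Span.at-last s′)))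

span-single : ∀ {w : Word n} {a p i j} → Span w a p p → At w i a → At w j a → ¬ i < j
span-single s at-i at-j i<j with span-pair s at-i at-j i<j
... | refl , refl = <-irrefl refl i<j

absent : ∀ {a : Fin n} w → occ a w ≡ 0 → ∀ {k} → ¬ At w k a
absent {a = a} (c ∷ w) eq at with c ≟ a
absent (c ∷ w) ()  at           | yes _
absent (c ∷ w) eq  at-head      | no c≢a = c≢a refl
absent (c ∷ w) eq  (at-tail at) | no c≢a = absent w eq at

span-shift : ∀ {w : Word n} {a c f l} → c ≢ a → Span w a f l → Span (c ∷ w) a (suc f) (suc l)
span-shift c≢a s = record
  { ordered = s≤s ordered ; at-first = at-tail at-first ; at-last = at-tail at-last
  ; only = λ { at-head → ⊥-elim (c≢a refl)
             ; (at-tail at) → Data.Sum.map (cong suc) (cong suc) (only at) }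
  }
  where open Span s

span-once : ∀ {a : Fin n} w → occ a w ≡ 1 → Σ ℕ λ p → Span w a p p
span-once {a = a} (c ∷ w) eq with c ≟ a
... | no c≢a   = let p , s = span-once w eq in suc p , span-shift c≢a s
... | yes refl = 0 , record
  { ordered = ≤-refl ; at-first = at-head ; at-last = at-head
  ; only = λ { at-head → inj₁ refl ; (at-tail at) → ⊥-elim (absent w (suc-injective eq) at) }
  }

span-twice : ∀ {a : Fin n} w → occ a w ≡ 2 → Σ ℕ λ f → Σ ℕ λ l → f < l × Span w a f l
span-twice {a = a} (c ∷ w) eq with c ≟ a
... | no c≢a   = let f , l , f<l , s = span-twice w eq in suc f , suc l , s≤s f<l , span-shift c≢a s
... | yes refl = let p , s = span-once w (suc-injective eq) in 0 , suc p , s≤s z≤n , record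
  { ordered = z≤n ; at-first = at-head ; at-last = at-tail (Span.at-first s)
  ; only = λ { at-head → inj₁ refl ; (at-tail at) → inj₂ (cong suc (Data.Sum.reduce (Span.only s at))) }
  }

data NonCrossing (f l g h : ℕ) : Set where
  before    : l < g → NonCrossing f l g h
  after     : h < f → NonCrossing f l g h
  surrounds : f < g → g < h → h < l → NonCrossing f l g h
  inside    : g < f → f < l → l < h → NonCrossing f l g h

NonCrossing-flip : ∀ {f l g h} → NonCrossing g h f l → NonCrossing f l g h
NonCrossing-flip (before h<f)           = after h<f
NonCrossing-flip (after l<g)            = before l<g
NonCrossing-flip (surrounds g<f f<l l<h) = inside g<f f<l l<h
NonCrossing-flip (inside f<g g<h h<l)    = surrounds f<g g<h h<l

outside : ∀ {f l k} → k ≢ f → k ≢ l → ¬ (f < k × k < l) → k < f ⊎ l < k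
outside {f} {l} {k} k≢f k≢l ¬in with <-cmp k f | <-cmp k l
... | tri< k<f _ _ | _            = inj₁ k<f
... | tri≈ _ k≡f _ | _            = ⊥-elim (k≢f k≡f)
... | tri> _ _ f<k | tri< k<l _ _ = ⊥-elim (¬in (f<k , k<l))
... | tri> _ _ f<k | tri≈ _ k≡l _ = ⊥-elim (k≢l k≡l)
... | tri> _ _ f<k | tri> _ _ l<k = inj₂ l<k

avoiding-interval : ∀ {f l g h} → f < l → g ≤ h → g < f ⊎ l < g → h < f ⊎ l < h → NonCrossing f l g h
avoiding-interval f<l g≤h (inj₁ g<f) (inj₁ h<f) = after h<f
avoiding-interval f<l g≤h (inj₁ g<f) (inj₂ l<h) = inside g<f f<l l<h
avoiding-interval f<l g≤h (inj₂ l<g) _          = before l<g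

meets-inside : ∀ {w : Word n} {v f l g h k} → NonCrossing f l g h → Span w v g h → At w k v →
  f < k → k < l → f < g × g < h × h < l
meets-inside (before l<g) s at f<k k<l =
  ⊥-elim (<-irrefl refl (<-≤-trans (<-trans k<l l<g) (proj₁ (span-bounds s at))))
meets-inside (after h<f) s at f<k k<l =
  ⊥-elim (<-irrefl refl (<-trans (≤-<-trans (proj₂ (span-bounds s at)) h<f) f<k))
meets-inside (surrounds f<g g<h h<l) s at f<k k<l = f<g , g<h , h<l
meets-inside (inside g<f f<l l<h) s at f<k k<l with Span.only s at
... | inj₁ refl = ⊥-elim (<-asym g<f f<k)
... | inj₂ refl = ⊥-elim (<-asym k<l l<h)

module Selection {P : Fin n → Set} (P? : Decidable P) where

  first-selected : ∀ {w d r} → filter P? w ≡ d ∷ r →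
    Σ ℕ λ m → At w m d × (∀ {k b} → k < m → At w k b → ¬ P b)
  first-selected {c ∷ w} eq with P? c
  first-selected {c ∷ w} refl | yes _ = 0 , at-head , λ ()
  first-selected {c ∷ w} eq   | no ¬Pc with first-selected {w} eq
  ... | m , at , unselected = suc m , at-tail at , earlier
    where
    earlier : ∀ {k b} → k < suc m → At (c ∷ w) k b → ¬ P b
    earlier _         at-head      = ¬Pc
    earlier (s≤s k<m) (at-tail at) = unselected k<m at

  first-selected-before : ∀ {w j a} → At w j a → P a →
    Σ ℕ λ m → Σ (Fin n) λ d → Σ (Word n) λ r →
      filter P? w ≡ d ∷ r × At w m d × P d × m ≤ j
  first-selected-before {c ∷ w} at Pa with P? c
  ... | yes Pc = 0 , c , filter P? w , refl , at-head , Pc , z≤n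
  first-selected-before {c ∷ w} at-head      Pa | no ¬Pc = ⊥-elim (¬Pc Pa)
  first-selected-before {c ∷ w} (at-tail at) Pa | no ¬Pc with first-selected-before at Pa
  ... | m , d , r , eq , at-m , Pd , m≤j = suc m , d , r , eq , at-tail at-m , Pd , s≤s m≤j

  NoRepeat-tail : ∀ {c w} → NoRepeat (filter P? (c ∷ w)) → NoRepeat (filter P? w)
  NoRepeat-tail {c} nr with P? c
  ... | no _  = nr
  ... | yes _ = drop-head nr
    where
    drop-head : ∀ {a : Fin n} {v} → NoRepeat (a ∷ v) → NoRepeat v
    drop-head one        = nil
    drop-head (cons _ r) = r

  separated : ∀ {w i j a} → NoRepeat (filter P? w) → At w i a → At w j a → i < j → P a →
    Σ ℕ λ k → Σ (Fin n) λ b → i < k × k < j × At w k b × P b × b ≢ a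
  separated {a ∷ w} nr at-head (at-tail at-j) _ Pa with P? a
  ... | no ¬Pa = ⊥-elim (¬Pa Pa)
  ... | yes _ with first-selected-before at-j Pa
  ...   | m , d , r , eq , at-m , Pd , m≤j rewrite eq with nr | m≤n⇒m<n∨m≡n m≤j
  ...     | cons a≢d _ | inj₁ m<j = suc m , d , s≤s z≤n , s≤s m<j , at-tail at-m , Pd , λ d≡a → a≢d (sym d≡a)
  ...     | cons a≢d _ | inj₂ refl = ⊥-elim (a≢d (At-functional at-j at-m))
  separated {c ∷ w} nr (at-tail at-i) (at-tail at-j) (s≤s i<j) Pa
    with separated (NoRepeat-tail {c} nr) at-i at-j i<j Pa
  ... | k , b , i<k , k<j , at-k , Pb , b≢a = suc k , b , s≤s i<k , s≤s k<j , at-tail at-k , Pb , b≢a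

  record Gap (w : Word n) : Set where
    field
      left right   : ℕ
      letter       : Fin n
      left<right   : left < right
      at-left      : At w left letter
      at-right     : At w right letter
      selected     : P letter
      nothing-between : ∀ {k b} → left < k → k < right → At w k b → ¬ P b

  gap-shift : ∀ {c w} → Gap w → Gap (c ∷ w)
  gap-shift g = record
    { left = suc left ; right = suc right ; letter = letter
    ; left<right = s≤s left<right
    ; at-left = at-tail at-left ; at-right = at-tail at-right
    ; selected = selected
    ; nothing-between = λ { (s≤s l<k) (s≤s k<r) (at-tail at) → nothing-between l<k k<r at }
    }
    where open Gap g

  gap : ∀ w → ¬ NoRepeat (filter P? w) → Gap w
  gap []      ¬nr = ⊥-elim (¬nr nil)
  gap (c ∷ w) ¬nr with P? c
  ... | no _ = gap-shift (gap w ¬nr)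
  ... | yes Pc with filter P? w in eq
  ...   | [] = ⊥-elim (¬nr one)
  ...   | d ∷ r with c ≟ d
  ...     | no c≢d = gap-shift (gap w λ nr → ¬nr (cons c≢d (subst NoRepeat eq nr)))
  ...     | yes refl with first-selected {w} eq
  ...       | m , at-m , unselected = record
    { left = 0 ; right = suc m ; letter = c
    ; left<right = s≤s z≤n
    ; at-left = at-head ; at-right = at-tail at-m
    ; selected = Pc
    ; nothing-between = λ { _ (s≤s k<m) (at-tail at) → unselected k<m at }
    }

NoRepeat? : (w : Word n) → Dec (NoRepeat w)
NoRepeat? []          = yes nil
NoRepeat? (a ∷ [])    = yes one
NoRepeat? (a ∷ b ∷ w) with a ≟ b | NoRepeat? (b ∷ w)
... | yes a≡b | _      = no λ { (cons a≢b _) → a≢b a≡b }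
... | no a≢b  | yes nr = yes (cons a≢b nr)
... | no _    | no ¬nr = no λ { (cons _ nr) → ¬nr nr }

clear-span : ∀ {w : Word n} {u v f l g h} → u ≢ v → Span w u f l → Span w v g h → f < l →
  (∀ {k} → f < k → k < l → ¬ At w k v) → NonCrossing f l g h
clear-span {w = w} {v = v} u≢v su sv f<l clear =
  avoiding-interval f<l (Span.ordered sv) (avoid (Span.at-first sv)) (avoid (Span.at-last sv))
  where
  avoid : ∀ {k} → At w k v → k < _ ⊎ _ < k
  avoid at = outside (λ { refl → u≢v (At-functional (Span.at-first su) at) })
                     (λ { refl → u≢v (At-functional (Span.at-last su) at) })
                     (λ { (f<k , k<l) → clear f<k k<l at })

pair? : (u v : Fin n) → Decidable (λ z → z ≡ u ⊎ z ≡ v)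
pair? u v z = (z ≟ u) ⊎-dec (z ≟ v)

module Alternation {w : Word n} {u v : Fin n} where
  open Selection (pair? u v)

  alternate-between : ∀ {f l} → Alternate w u v → Span w u f l → f < l →
    Σ ℕ λ k → f < k × k < l × At w k v
  alternate-between alt su f<l with separated alt (Span.at-first su) (Span.at-last su) f<l (inj₁ refl)
  ... | k , _ , f<k , k<l , at , inj₁ refl , b≢u = ⊥-elim (b≢u refl)
  ... | k , _ , f<k , k<l , at , inj₂ refl , _   = k , f<k , k<l , at

  singles-alternate : ∀ {p q} → Span w u p p → Span w v q q → Alternate w u v
  singles-alternate su sv with NoRepeat? (restrict u v w)
  ... | yes alt = alt
  ... | no ¬alt with gap w ¬alt
  ...   | record { left<right = i<j ; at-left = at-i ; at-right = at-j ; selected = inj₁ refl } =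
          ⊥-elim (span-single su at-i at-j i<j)
  ...   | record { left<right = i<j ; at-left = at-i ; at-right = at-j ; selected = inj₂ refl } =
          ⊥-elim (span-single sv at-i at-j i<j)

  noncrossing : ∀ {f l g h} → u ≢ v → ¬ Alternate w u v → Span w u f l → Span w v g h →
    NonCrossing f l g h
  noncrossing u≢v ¬alt su sv with gap w ¬alt
  ... | record { left<right = i<j ; at-left = at-i ; at-right = at-j ; selected = inj₁ refl
               ; nothing-between = clear } with span-pair su at-i at-j i<j
  ...   | refl , refl = clear-span u≢v su sv i<j λ f<k k<l at → clear f<k k<l at (inj₂ refl)
  noncrossing u≢v ¬alt su sv
      | record { left<right = i<j ; at-left = at-i ; at-right = at-j ; selected = inj₂ refl
               ; nothing-between = clear } with span-pair sv at-i at-j i<j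
  ...   | refl , refl = NonCrossing-flip
                          (clear-span (λ v≡u → u≢v (sym v≡u)) sv su i<j λ g<k k<h at → clear g<k k<h at (inj₁ refl))

alternate-sym : ∀ {w : Word n} {u v} → Alternate w u v → Alternate w v u
alternate-sym {w = w} = subst NoRepeat (filter-≐ _ _ (Data.Sum.swap , Data.Sum.swap) w)

-- The length of a word is the sum over the alphabet of the numbers of
-- occurrences; hence a word using every letter at most as often as another
-- word, and some letter strictly less often, is strictly shorter.
module Counting where
  open import Algebra.Properties.CommutativeMonoid.Sum +-0-commutativeMonoid
    using (sum; sum-cong-≗; ∑-distrib-+; sum-remove; sum-replicate-zero)

  sum-mono-≤ : ∀ {m} {f g : Fin m → ℕ} → (∀ v → f v ≤ g v) → sum f ≤ sum g
  sum-mono-≤ {zero}  f≤g = z≤n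
  sum-mono-≤ {suc m} f≤g = +-mono-≤ (f≤g zero) (sum-mono-≤ (λ v → f≤g (suc v)))

  sum-mono-< : ∀ {m} {f g : Fin m → ℕ} → (∀ v → f v ≤ g v) → ∀ u → f u < g u → sum f < sum g
  sum-mono-< f≤g zero    fu<gu = +-mono-<-≤ fu<gu (sum-mono-≤ (λ v → f≤g (suc v)))
  sum-mono-< f≤g (suc u) fu<gu = +-mono-≤-< (f≤g zero) (sum-mono-< (λ v → f≤g (suc v)) u fu<gu)

  occ-cons : ∀ {a c : Fin n} w → occ a (c ∷ w) ≡ occ a (c ∷ []) + occ a w
  occ-cons {a = a} {c} w = trans (cong length (filter-++ (_≟ a) (c ∷ []) w)) (length-++ (filter (_≟ a) (c ∷ [])))

  sum-occ-letter : (c : Fin n) → sum (λ v → occ v (c ∷ [])) ≡ 1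
  sum-occ-letter {suc m} c = begin
    sum (λ v → occ v (c ∷ []))                               ≡⟨ sum-remove {i = c} (λ v → occ v (c ∷ [])) ⟩
    occ c (c ∷ []) + sum (λ j → occ (punchIn c j) (c ∷ []))  ≡⟨ cong₂ _+_ (cong length (filter-accept (_≟ c) refl))
                                                                         (sum-cong-≗ {m} other) ⟩
    1 + sum {m} (λ _ → 0)                                     ≡⟨ cong suc (sum-replicate-zero m) ⟩
    1                                                         ∎
    where
    open ≡-Reasoning
    other : ∀ j → occ (punchIn c j) (c ∷ []) ≡ 0
    other j = cong length (filter-reject (_≟ punchIn c j) (λ c≡ → punchInᵢ≢i c j (sym c≡)))

  length-as-sum : ∀ {n} (w : Word n) → length w ≡ sum (λ v → occ v w)
  length-as-sum {n} []  = sym (sum-replicate-zero n)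
  length-as-sum (c ∷ w) = sym (begin
    sum (λ v → occ v (c ∷ w))                               ≡⟨ sum-cong-≗ (λ v → occ-cons {a = v} {c} w) ⟩
    sum (λ v → occ v (c ∷ []) + occ v w)                    ≡⟨ ∑-distrib-+ (λ v → occ v (c ∷ [])) (λ v → occ v w) ⟩
    sum (λ v → occ v (c ∷ [])) + sum (λ v → occ v w)        ≡⟨ cong₂ _+_ (sum-occ-letter c) (sym (length-as-sum w)) ⟩
    suc (length w)                                          ∎)
    where open ≡-Reasoning

  fewer-occurrences-shorter : ∀ {W w : Word n} → (∀ v → occ v W ≤ occ v w) → ∀ z → occ z W < occ z w →
    length W < length w
  fewer-occurrences-shorter {W = W} {w} le z lt =
    subst₂ _<_ (sym (length-as-sum W)) (sym (length-as-sum w)) (sum-mono-< le z lt)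

module AvoidingWalks {G : Graph n} where

  reverse-edge : ∀ {u v a b : Fin n} → SameEdge u v a b → SameEdge v u a b
  reverse-edge (inj₁ (u≡a , v≡b)) = inj₂ (v≡b , u≡a)
  reverse-edge (inj₂ (u≡b , v≡a)) = inj₁ (v≡a , u≡b)

  walk-snoc : ∀ {a b p q r} → WalkAvoiding G a b p q → Adj G q r → ¬ SameEdge q r a b →
    WalkAvoiding G a b p r
  walk-snoc here            e ¬ab = step e ¬ab here
  walk-snoc (step e′ ¬ab′ w) e ¬ab = step e′ ¬ab′ (walk-snoc w e ¬ab)

  walk-++ : ∀ {a b p q r} → WalkAvoiding G a b p q → WalkAvoiding G a b q r → WalkAvoiding G a b p r
  walk-++ here          w′ = w′
  walk-++ (step e ¬ab w) w′ = step e ¬ab (walk-++ w w′)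

  walk-reverse : ∀ {a b p q} → WalkAvoiding G a b p q → WalkAvoiding G a b q p
  walk-reverse here           = here
  walk-reverse (step e ¬ab w) = walk-snoc (walk-reverse w) (Graph.sym G e) (¬ab ∘′ reverse-edge)

  walk-swap : ∀ {a b p q} → WalkAvoiding G a b p q → WalkAvoiding G b a p q
  walk-swap here           = here
  walk-swap (step e ¬ab w) = step e (λ ab → ¬ab (Data.Sum.swap ab)) (walk-swap w)

repeated : ∀ (X : Word n) {a Y} → ¬ NoRepeat (X ++ a ∷ a ∷ Y)
repeated []          (cons a≢a _) = a≢a refl
repeated (_ ∷ [])    (cons _ r)   = repeated [] r
repeated (_ ∷ d ∷ X) (cons _ r)   = repeated (d ∷ X) r

filter-agree : ∀ {P Q : Fin n → Set} (P? : Decidable P) (Q? : Decidable Q) (xs : Word n) →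
  (∀ {z} → z ∈ xs → P z → Q z) → (∀ {z} → z ∈ xs → Q z → P z) → filter P? xs ≡ filter Q? xs
filter-agree P? Q? []       _   _   = refl
filter-agree P? Q? (c ∷ xs) P⇒Q Q⇒P with P? c | Q? c
... | yes _  | yes _  = cong (c ∷_) (filter-agree P? Q? xs (λ z∈ → P⇒Q (there z∈)) (λ z∈ → Q⇒P (there z∈)))
... | no _   | no _   = filter-agree P? Q? xs (λ z∈ → P⇒Q (there z∈)) (λ z∈ → Q⇒P (there z∈))
... | yes Pc | no ¬Qc = ⊥-elim (¬Qc (P⇒Q (here refl) Pc))
... | no ¬Pc | yes Qc = ⊥-elim (¬Pc (Q⇒P (here refl) Qc))

first-occurrence : ∀ {p : Fin n} W → p ∈ W → Σ (Word n) λ A → Σ (Word n) λ B → W ≡ A ++ p ∷ B × p ∉ A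
first-occurrence {p = p} (c ∷ W) p∈ with c ≟ p | p∈
... | yes refl | _ = [] , W , refl , λ ()
... | no c≢p | here refl = ⊥-elim (c≢p refl)
... | no c≢p | there p∈W with first-occurrence W p∈W
...   | A , B , refl , p∉A = c ∷ A , B , refl , λ { (here refl) → c≢p refl ; (there p∈A) → p∉A p∈A }

-- The word is grown
-- one vertex at a time: attaching a new leaf ℓ to a vertex p already
-- represented replaces the first occurrence of p by ℓ p ℓ.
module TreeWord (T : Graph n) (acyclic : ∀ a b → Adj T a b → ¬ WalkAvoiding T a b a b)
                {x y : Fin n} (x≢y : x ≢ y) (xy : Adj T x y) where
  open AvoidingWalks {G = T}

  -- W represents the subtree of T spanned by the vertex list S, which
  -- contains the edge xy; `connected` says that S is connected inside S:
  -- any two of its vertices are joined avoiding every edge that leaves S.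
  record Partial (S : List (Fin n)) (W : Word n) : Set where
    field
      x∈S        : x ∈ S
      y∈S        : y ∈ S
      S⊆W        : ∀ {z} → z ∈ S → z ∈ W
      W⊆S        : ∀ {z} → z ∈ W → z ∈ S
      represents : ∀ {u v} → u ∈ S → v ∈ S → u ≢ v → (Adj T u v ⇔ Alternate W u v)
      twice      : ∀ z → occ z W ≤ 2
      x-once     : occ x W ≤ 1
      y-once     : occ y W ≤ 1
      connected  : ∀ {p q a} b → p ∈ S → q ∈ S → a ∉ S → WalkAvoiding T a b p q

  module Leaf {S : List (Fin n)} {A B : Word n} {p ℓ : Fin n} (P : Partial S (A ++ p ∷ B))
              (p∈S : p ∈ S) (ℓ∉S : ℓ ∉ S) (p∉A : p ∉ A) (pℓ : Adj T p ℓ) where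
    open Partial P

    W W′ : Word n
    W  = A ++ p ∷ B
    W′ = A ++ ℓ ∷ p ∷ ℓ ∷ B

    ℓ∉A : ℓ ∉ A
    ℓ∉A ℓ∈A = ℓ∉S (W⊆S (∈-++⁺ˡ ℓ∈A))
    ℓ∉B : ℓ ∉ B
    ℓ∉B ℓ∈B = ℓ∉S (W⊆S (∈-++⁺ʳ A (there ℓ∈B)))
    ℓ≢ : ∀ {z} → z ∈ S → ℓ ≢ z
    ℓ≢ z∈S refl = ℓ∉S z∈S

    module Selected {Q : Fin n → Set} (Q? : Decidable Q) where
      without-ℓ : ¬ Q ℓ → filter Q? W′ ≡ filter Q? W
      without-ℓ ¬Qℓ = begin
        filter Q? (A ++ ℓ ∷ p ∷ ℓ ∷ B)             ≡⟨ filter-++ Q? A (ℓ ∷ p ∷ ℓ ∷ B) ⟩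
        filter Q? A ++ filter Q? (ℓ ∷ p ∷ ℓ ∷ B)   ≡⟨ cong (filter Q? A ++_) middle ⟩
        filter Q? A ++ filter Q? (p ∷ B)           ≡⟨ filter-++ Q? A (p ∷ B) ⟨
        filter Q? (A ++ p ∷ B)                     ∎
        where
        open ≡-Reasoning
        middle : filter Q? (ℓ ∷ p ∷ ℓ ∷ B) ≡ filter Q? (p ∷ B)
        middle = trans (filter-reject Q? ¬Qℓ) after-p
          where
          after-p : filter Q? (p ∷ ℓ ∷ B) ≡ filter Q? (p ∷ B)
          after-p with Q? p
          ... | yes _ = cong (p ∷_) (filter-reject Q? ¬Qℓ)
          ... | no _  = filter-reject Q? ¬Qℓ

      with-ℓ : Q ℓ → ¬ Q p → filter Q? W′ ≡ filter Q? A ++ ℓ ∷ ℓ ∷ filter Q? B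
      with-ℓ Qℓ ¬Qp = trans (filter-++ Q? A (ℓ ∷ p ∷ ℓ ∷ B)) (cong (filter Q? A ++_) middle)
        where
        middle : filter Q? (ℓ ∷ p ∷ ℓ ∷ B) ≡ ℓ ∷ ℓ ∷ filter Q? B
        middle = trans (filter-accept Q? Qℓ) (cong (ℓ ∷_)
                   (trans (filter-reject Q? ¬Qp) (filter-accept Q? Qℓ)))

      with-ℓ-and-p : Q ℓ → Q p → filter Q? W′ ≡ filter Q? A ++ ℓ ∷ p ∷ ℓ ∷ filter Q? B
      with-ℓ-and-p Qℓ Qp = trans (filter-++ Q? A (ℓ ∷ p ∷ ℓ ∷ B)) (cong (filter Q? A ++_) middle)
        where
        middle : filter Q? (ℓ ∷ p ∷ ℓ ∷ B) ≡ ℓ ∷ p ∷ ℓ ∷ filter Q? B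
        middle = trans (filter-accept Q? Qℓ) (cong (ℓ ∷_)
                   (trans (filter-accept Q? Qp) (cong (p ∷_) (filter-accept Q? Qℓ))))
    open Selected

    -- T has no cycle through the edge pℓ, so ℓ has no other neighbour in S.
    leaf : ∀ {q} → q ∈ S → q ≢ p → ¬ Adj T ℓ q
    leaf {q} q∈S q≢p ℓq = acyclic ℓ p (Graph.sym T pℓ) (step ℓq not-ℓp (connected p q∈S p∈S ℓ∉S))
      where
      not-ℓp : ¬ SameEdge ℓ q ℓ p
      not-ℓp (inj₁ (_ , q≡p)) = q≢p q≡p
      not-ℓp (inj₂ (ℓ≡p , _)) = ℓ≢ p∈S ℓ≡p

    p-after : occ p B ≤ 1
    p-after = ≤-pred (≤-trans (m≤n+m (suc (occ p B)) (occ p A)) (subst (_≤ 2) occ-W (twice p)))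
      where
      occ-W : occ p W ≡ occ p A + suc (occ p B)
      occ-W = trans (cong length (trans (filter-++ (_≟ p) A (p ∷ B))
                                        (cong (filter (_≟ p) A ++_) (filter-accept (_≟ p) refl))))
                    (length-++ (filter (_≟ p) A))

    ℓ-p-alternate : Alternate W′ ℓ p
    ℓ-p-alternate = subst NoRepeat (sym restricted) (alternating (filter (_≟ p) B) p-after (λ z∈ → proj₂ (∈-filter⁻ (_≟ p) {xs = B} z∈)))
      where
      restricted : restrict ℓ p W′ ≡ ℓ ∷ p ∷ ℓ ∷ filter (_≟ p) B
      restricted = begin
        restrict ℓ p W′                                                 ≡⟨ with-ℓ-and-p (pair? ℓ p) (inj₁ refl) (inj₂ refl) ⟩
        filter (pair? ℓ p) A ++ ℓ ∷ p ∷ ℓ ∷ filter (pair? ℓ p) B        ≡⟨ cong₂ (λ L M → L ++ ℓ ∷ p ∷ ℓ ∷ M) none only-p ⟩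
        ℓ ∷ p ∷ ℓ ∷ filter (_≟ p) B                                     ∎
        where
        open ≡-Reasoning
        none : filter (pair? ℓ p) A ≡ []
        none = filter-none (pair? ℓ p) (tabulate λ { z∈A (inj₁ refl) → ℓ∉A z∈A ; z∈A (inj₂ refl) → p∉A z∈A })
        only-p : filter (pair? ℓ p) B ≡ filter (_≟ p) B
        only-p = filter-agree (pair? ℓ p) (_≟ p) B (λ { z∈B (inj₁ refl) → ⊥-elim (ℓ∉B z∈B) ; _ (inj₂ z≡p) → z≡p })
                                                    (λ _ → inj₂)
      ℓ≢p : ℓ ≢ p
      ℓ≢p = ℓ≢ p∈S
      alternating : ∀ L → length L ≤ 1 → (∀ {z} → z ∈ L → z ≡ p) → NoRepeat (ℓ ∷ p ∷ ℓ ∷ L)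
      alternating []          _         _    = cons ℓ≢p (cons (λ p≡ℓ → ℓ≢p (sym p≡ℓ)) one)
      alternating (d ∷ [])    _         only with only (here refl)
      ... | refl = cons ℓ≢p (cons (λ p≡ℓ → ℓ≢p (sym p≡ℓ)) (cons ℓ≢p one))
      alternating (_ ∷ _ ∷ _) (s≤s ()) _

    ℓ-represented : ∀ {q} → q ∈ S → (Adj T ℓ q ⇔ Alternate W′ ℓ q)
    ℓ-represented {q} q∈S with q ≟ p
    ... | yes refl = mk⇔ (λ _ → ℓ-p-alternate) (λ _ → Graph.sym T pℓ)
    ... | no q≢p   = mk⇔ (λ ℓq → ⊥-elim (leaf q∈S q≢p ℓq)) (λ alt → ⊥-elim (repeated _ (subst NoRepeat doubled alt)))
      where
      doubled : restrict ℓ q W′ ≡ filter (pair? ℓ q) A ++ ℓ ∷ ℓ ∷ filter (pair? ℓ q) B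
      doubled = with-ℓ (pair? ℓ q) (inj₁ refl) λ { (inj₁ p≡ℓ) → ℓ≢ p∈S (sym p≡ℓ) ; (inj₂ p≡q) → q≢p (sym p≡q) }

    represents′ : ∀ {u v} → u ∈ ℓ ∷ S → v ∈ ℓ ∷ S → u ≢ v → (Adj T u v ⇔ Alternate W′ u v)
    represents′ (here refl) (here refl) u≢v = ⊥-elim (u≢v refl)
    represents′ (here refl) (there v∈S) _   = ℓ-represented v∈S
    represents′ (there u∈S) (here refl) _   =
      mk⇔ (λ uℓ → alternate-sym {w = W′} (Equivalence.to (ℓ-represented u∈S) (Graph.sym T uℓ)))
          (λ alt → Graph.sym T (Equivalence.from (ℓ-represented u∈S) (alternate-sym {w = W′} alt)))
    represents′ {u} {v} (there u∈S) (there v∈S) u≢v =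
      mk⇔ (λ uv → subst NoRepeat (sym same) (Equivalence.to (represents u∈S v∈S u≢v) uv))
          (λ alt → Equivalence.from (represents u∈S v∈S u≢v) (subst NoRepeat same alt))
      where
      same : restrict u v W′ ≡ restrict u v W
      same = without-ℓ (pair? u v) λ { (inj₁ ℓ≡u) → ℓ≢ u∈S ℓ≡u ; (inj₂ ℓ≡v) → ℓ≢ v∈S ℓ≡v }

    occ-old : ∀ z → ℓ ≢ z → occ z W′ ≡ occ z W
    occ-old z ℓ≢z = cong length (without-ℓ (_≟ z) ℓ≢z)

    twice′ : ∀ z → occ z W′ ≤ 2
    twice′ z with ℓ ≟ z
    ... | no ℓ≢z   = subst (_≤ 2) (sym (occ-old z ℓ≢z)) (twice z)
    ... | yes refl = subst (_≤ 2) (sym (cong length ℓ-twice)) ≤-refl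
      where
      no-ℓ : ∀ {X} → ℓ ∉ X → filter (_≟ ℓ) X ≡ []
      no-ℓ ℓ∉X = filter-none (_≟ ℓ) (tabulate λ { z∈X refl → ℓ∉X z∈X })
      ℓ-twice : filter (_≟ ℓ) W′ ≡ ℓ ∷ ℓ ∷ []
      ℓ-twice = trans (with-ℓ (_≟ ℓ) refl (λ p≡ℓ → ℓ≢ p∈S (sym p≡ℓ)))
                      (cong₂ (λ L M → L ++ ℓ ∷ ℓ ∷ M) (no-ℓ ℓ∉A) (no-ℓ ℓ∉B))

    not-pℓ : ∀ {a} b → a ∉ ℓ ∷ S → ¬ SameEdge p ℓ a b
    not-pℓ b a∉ (inj₁ (refl , _)) = a∉ (there p∈S)
    not-pℓ b a∉ (inj₂ (_ , refl)) = a∉ (here refl)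

    connected′ : ∀ {q r a} b → q ∈ ℓ ∷ S → r ∈ ℓ ∷ S → a ∉ ℓ ∷ S → WalkAvoiding T a b q r
    connected′ b (here refl) (here refl) _   = here
    connected′ b (here refl) (there r∈S) a∉ =
      step (Graph.sym T pℓ) (not-pℓ b a∉ ∘′ reverse-edge) (connected b p∈S r∈S (a∉ ∘′ there))
    connected′ b (there q∈S) (here refl) a∉ = walk-snoc (connected b q∈S p∈S (a∉ ∘′ there)) pℓ (not-pℓ b a∉)
    connected′ b (there q∈S) (there r∈S) a∉ = connected b q∈S r∈S (a∉ ∘′ there)

    extended : Partial (ℓ ∷ S) W′
    extended = record
      { x∈S = there x∈S ; y∈S = there y∈S
      ; S⊆W = λ { (here refl) → ∈-++⁺ʳ A (here refl) ; (there z∈S) → old-letter (S⊆W z∈S) }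
      ; W⊆S = λ z∈W′ → new-letter z∈W′
      ; represents = represents′
      ; twice = twice′
      ; x-once = subst (_≤ 1) (sym (occ-old x (ℓ≢ x∈S))) x-once
      ; y-once = subst (_≤ 1) (sym (occ-old y (ℓ≢ y∈S))) y-once
      ; connected = connected′
      }
      where
      old-letter : ∀ {z} → z ∈ W → z ∈ W′
      old-letter z∈W with ∈-++⁻ A z∈W
      ... | inj₁ z∈A          = ∈-++⁺ˡ z∈A
      ... | inj₂ (here z≡p)   = ∈-++⁺ʳ A (there (here z≡p))
      ... | inj₂ (there z∈B)  = ∈-++⁺ʳ A (there (there (there z∈B)))
      new-letter : ∀ {z} → z ∈ W′ → z ∈ ℓ ∷ S
      new-letter z∈W′ with ∈-++⁻ A z∈W′
      ... | inj₁ z∈A                          = there (W⊆S (∈-++⁺ˡ z∈A))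
      ... | inj₂ (here z≡ℓ)                   = here z≡ℓ
      ... | inj₂ (there (here z≡p))           = there (W⊆S (∈-++⁺ʳ A (here z≡p)))
      ... | inj₂ (there (there (here z≡ℓ)))   = here z≡ℓ
      ... | inj₂ (there (there (there z∈B)))  = there (W⊆S (∈-++⁺ʳ A (there z∈B)))

  open Partial

  add-leaf : ∀ {S W p ℓ} → Partial S W → p ∈ S → ℓ ∉ S → Adj T p ℓ → Σ (Word n) (Partial (ℓ ∷ S))
  add-leaf {S} {W} {p} P p∈S ℓ∉S pℓ with first-occurrence W (S⊆W P p∈S)
  ... | A , B , refl , p∉A = _ , Leaf.extended P p∈S ℓ∉S p∉A pℓ

  add-walk : ∀ {S W u z} → Partial S W → u ∈ S → Walk T u z →
    Σ (List (Fin n)) λ S′ → Σ (Word n) λ W′ → Partial S′ W′ × z ∈ S′ × (∀ {v} → v ∈ S → v ∈ S′)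
  add-walk {S} {W} P u∈S here = S , W , P , u∈S , λ v∈S → v∈S
  add-walk {S} {W} P u∈S (step {v = v} uv rest) with member? _≟_ v S
  ... | yes v∈S = add-walk P v∈S rest
  ... | no v∉S with add-leaf P u∈S v∉S uv
  ...   | W′ , P′ with add-walk P′ (here refl) rest
  ...     | S″ , W″ , P″ , z∈S″ , S′⊆S″ = S″ , W″ , P″ , z∈S″ , λ v∈S → S′⊆S″ (there v∈S)

  add-all : ∀ {S W} → Connected T → Partial S W → (L : List (Fin n)) →
    Σ (List (Fin n)) λ S′ → Σ (Word n) λ W′ → Partial S′ W′ × (∀ {z} → z ∈ L → z ∈ S′) × (∀ {v} → v ∈ S → v ∈ S′)
  add-all {S} {W} conn P []      = S , W , P , (λ ()) , λ v∈S → v∈S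
  add-all {S} {W} conn P (c ∷ L) with add-walk P (x∈S P) (conn x c)
  ... | S₁ , W₁ , P₁ , c∈S₁ , S⊆S₁ with add-all conn P₁ L
  ...   | S₂ , W₂ , P₂ , L⊆S₂ , S₁⊆S₂ =
    S₂ , W₂ , P₂ , (λ { (here refl) → S₁⊆S₂ c∈S₁ ; (there z∈L) → L⊆S₂ z∈L }) , λ v∈S → S₁⊆S₂ (S⊆S₁ v∈S)

  start : Partial (x ∷ y ∷ []) (x ∷ y ∷ [])
  start = record
    { x∈S = here refl ; y∈S = there (here refl)
    ; S⊆W = λ z∈ → z∈ ; W⊆S = λ z∈ → z∈
    ; represents = represents₀
    ; twice = λ z → length-filter (_≟ z) (x ∷ y ∷ [])
    ; x-once = subst (_≤ 1) (sym (cong length (trans (filter-accept (_≟ x) refl)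
                                       (cong (x ∷_) (filter-reject (_≟ x) (λ y≡x → x≢y (sym y≡x))))))) ≤-refl
    ; y-once = subst (_≤ 1) (sym (cong length (trans (filter-reject (_≟ y) x≢y) (filter-accept (_≟ y) refl)))) ≤-refl
    ; connected = connected₀
    }
    where
    not-xy : ∀ {a b} → a ∉ x ∷ y ∷ [] → ¬ SameEdge x y a b
    not-xy a∉ (inj₁ (refl , _)) = a∉ (here refl)
    not-xy a∉ (inj₂ (_ , refl)) = a∉ (there (here refl))
    both : ∀ {Q : Fin n → Set} (Q? : Decidable Q) → Q x → Q y → filter Q? (x ∷ y ∷ []) ≡ x ∷ y ∷ []
    both Q? Qx Qy = trans (filter-accept Q? Qx) (cong (x ∷_) (filter-accept Q? Qy))
    xy-alternate : Alternate (x ∷ y ∷ []) x y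
    xy-alternate = subst NoRepeat (sym (both (pair? x y) (inj₁ refl) (inj₂ refl))) (cons x≢y one)
    represents₀ : ∀ {u v} → u ∈ x ∷ y ∷ [] → v ∈ x ∷ y ∷ [] → u ≢ v → (Adj T u v ⇔ Alternate (x ∷ y ∷ []) u v)
    represents₀ (here refl)         (here refl)         u≢v = ⊥-elim (u≢v refl)
    represents₀ (here refl)         (there (here refl)) u≢v = mk⇔ (λ _ → xy-alternate) (λ _ → xy)
    represents₀ (there (here refl)) (here refl)         u≢v = mk⇔ (λ _ → alternate-sym {w = x ∷ y ∷ []} xy-alternate) (λ _ → Graph.sym T xy)
    represents₀ (there (here refl)) (there (here refl)) u≢v = ⊥-elim (u≢v refl)
    connected₀ : ∀ {p q a} b → p ∈ x ∷ y ∷ [] → q ∈ x ∷ y ∷ [] → a ∉ x ∷ y ∷ [] → WalkAvoiding T a b p q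
    connected₀ b (here refl)         (here refl)         _  = here
    connected₀ b (there (here refl)) (there (here refl)) _  = here
    connected₀ b (here refl)         (there (here refl)) a∉ = step xy (not-xy a∉) here
    connected₀ b (there (here refl)) (here refl)         a∉ = step (Graph.sym T xy) (not-xy a∉ ∘′ reverse-edge) here

  tree-word : Connected T →
    Σ (Word n) λ W → Represents W T × (∀ z → occ z W ≤ 2) × occ x W ≤ 1 × occ y W ≤ 1
  tree-word conn with add-all conn start (allFin n)
  ... | S , W , P , all⊆S , _ =
    W , ((λ v → S⊆W P (all⊆S (∈-allFin v))) , (λ u v → represents P (all⊆S (∈-allFin u)) (all⊆S (∈-allFin v)))) ,
    twice P , x-once P , y-once P

module Analysis {n : ℕ} (T : Graph n) (tree : IsTree T) (w : Word n) (minimal : MinRepresents w T)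
                {x y : Fin n} (x≢y : x ≢ y) (x-once : occ x w ≡ 1) (y-once : occ y w ≡ 1)
                (x-before-y : ∀ {i j} → At w i x → At w j y → i < j) where
  open AvoidingWalks {G = T}
  open Alternation

  acyclic : ∀ a b → Adj T a b → ¬ WalkAvoiding T a b a b
  acyclic = proj₂ tree

  contains-all : ∀ z → z ∈ w
  contains-all = proj₁ (proj₁ minimal)

  represents : ∀ u v → u ≢ v → (Adj T u v ⇔ Alternate w u v)
  represents = proj₂ (proj₁ minimal)

  adjacent⇒alternate : ∀ {u v} → Adj T u v → Alternate w u v
  adjacent⇒alternate {u} {v} uv = Equivalence.to (represents u v λ { refl → Graph.irrefl T uv }) uv

  alternate⇒adjacent : ∀ {u v} → u ≢ v → Alternate w u v → Adj T u v
  alternate⇒adjacent {u} {v} u≢v = Equivalence.from (represents u v u≢v)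

  x-position y-position : ℕ
  x-position = proj₁ (span-once w x-once)
  y-position = proj₁ (span-once w y-once)

  x-span : Span w x x-position x-position
  x-span = proj₂ (span-once w x-once)

  y-span : Span w y y-position y-position
  y-span = proj₂ (span-once w y-once)

  singles-adjacent : ∀ {u v p q} → u ≢ v → Span w u p p → Span w v q q → Adj T u v
  singles-adjacent u≢v su sv = alternate⇒adjacent u≢v (singles-alternate su sv)

  xy : Adj T x y
  xy = singles-adjacent x≢y x-span y-span

  A B : Fin n → Set
  A = InComponent T x y
  B = InComponent T y x

  A-walk : ∀ {u} → WalkAvoiding T x y u x → A u
  A-walk = walk-reverse

  B-walk : ∀ {v} → WalkAvoiding T x y v y → B v
  B-walk walk = walk-swap (walk-reverse walk)

  sides-disjoint : ∀ {z} → A z → B z → ⊥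
  sides-disjoint a b = acyclic x y xy (walk-++ a (walk-reverse (walk-swap b)))

  no-cross-edge : ∀ {u v} → A u → B v → ¬ (u ≡ x × v ≡ y) → ¬ Adj T u v
  no-cross-edge {u} {v} a b not-xy uv =
    acyclic x y xy (walk-++ a (step uv not-same (walk-reverse (walk-swap b))))
    where
    not-same : ¬ SameEdge u v x y
    not-same (inj₁ u≡x,v≡y)  = not-xy u≡x,v≡y
    not-same (inj₂ (refl , _)) = sides-disjoint a here

  -- A vertex other than x, y occurring once would be adjacent to both,
  -- closing the cycle x z y.
  others-at-least-twice : ∀ {z} → z ≢ x → z ≢ y → 2 ≤ occ z w
  others-at-least-twice {z} z≢x z≢y with occ z w in eq
  ... | zero = ⊥-elim (absent w eq (proj₂ (∈⇒At (contains-all z))))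
  ... | suc (suc _) = s≤s (s≤s z≤n)
  ... | suc zero with span-once w eq
  ...   | _ , z-span = ⊥-elim (acyclic x y xy (step xz not-xz (step zy not-zy here)))
    where
    xz : Adj T x z
    xz = singles-adjacent (λ x≡z → z≢x (sym x≡z)) x-span z-span
    zy : Adj T z y
    zy = singles-adjacent z≢y z-span y-span
    not-xz : ¬ SameEdge x z x y
    not-xz (inj₁ (_ , z≡y)) = z≢y z≡y
    not-xz (inj₂ (x≡y , _)) = x≢y x≡y
    not-zy : ¬ SameEdge z y x y
    not-zy (inj₁ (z≡x , _)) = z≢x z≡x
    not-zy (inj₂ (z≡y , _)) = z≢y z≡y

  -- By minimality: a vertex occurring three times would make the word of
  -- `TreeWord` strictly shorter than w.
  others-at-most-twice : ∀ {z} → z ≢ x → z ≢ y → occ z w ≤ 2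
  others-at-most-twice {z} z≢x z≢y with occ z w ≤? 2
  ... | yes ≤2 = ≤2
  ... | no >2 with TreeWord.tree-word T acyclic x≢y xy (proj₁ tree)
  ...   | W , W-represents , W-twice , W-x , W-y =
    ⊥-elim (<-irrefl refl (≤-<-trans (proj₂ minimal W W-represents)
                                    (Counting.fewer-occurrences-shorter {W = W} {w} fewer z (≤-<-trans (W-twice z) (≰⇒> >2)))))
    where
    fewer : ∀ v → occ v W ≤ occ v w
    fewer v with v ≟ x | v ≟ y
    ... | yes refl | _        = subst (occ x W ≤_) (sym x-once) W-x
    ... | no _     | yes refl = subst (occ y W ≤_) (sym y-once) W-y
    ... | no v≢x   | no v≢y   = ≤-trans (W-twice v) (others-at-least-twice v≢x v≢y)

  others-twice : ∀ {z} → z ≢ x → z ≢ y → occ z w ≡ 2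
  others-twice z≢x z≢y = ≤-antisym (others-at-most-twice z≢x z≢y) (others-at-least-twice z≢x z≢y)

  span-of : ∀ z → Σ ℕ λ f → Σ ℕ λ l → Span w z f l
  span-of z with z ≟ x | z ≟ y
  ... | yes refl | _        = _ , _ , x-span
  ... | no _     | yes refl = _ , _ , y-span
  ... | no z≢x   | no z≢y   =
    let f , l , _ , s = span-twice w (others-twice z≢x z≢y)
    in f , l , s

  first last : Fin n → ℕ
  first z = proj₁ (span-of z)
  last  z = proj₁ (proj₂ (span-of z))

  span : ∀ z → Span w z (first z) (last z)
  span z = proj₂ (proj₂ (span-of z))

  twice : ∀ {z} → z ≢ x → z ≢ y → first z < last z
  twice {z} z≢x z≢y with span-twice w (others-twice z≢x z≢y)
  ... | f , l , f<l , s = let f≡ , l≡ = span-unique s (span z) in subst₂ _<_ f≡ l≡ f<l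

  x-single : first x ≡ last x
  x-single = let p≡f , p≡l = span-unique x-span (span x) in trans (sym p≡f) p≡l

  y-single : first y ≡ last y
  y-single = let p≡f , p≡l = span-unique y-span (span y) in trans (sym p≡f) p≡l

  A-not-y : ∀ {u} → A u → u ≢ y
  A-not-y a refl = sides-disjoint a here

  B-not-x : ∀ {v} → B v → v ≢ x
  B-not-x b refl = sides-disjoint here b

  cross-noncrossing : ∀ {u v} → A u → B v → ¬ (u ≡ x × v ≡ y) →
    NonCrossing (first u) (last u) (first v) (last v)
  cross-noncrossing a b not-xy =
    noncrossing (λ { refl → sides-disjoint a b })
                (λ alt → no-cross-edge a b not-xy (alternate⇒adjacent (λ { refl → sides-disjoint a b }) alt))
                (span _) (span _)

  neighbour-inside : ∀ {v v′} → Adj T v v′ → first v < last v →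
    Σ ℕ λ k → first v < k × k < last v × At w k v′
  neighbour-inside vv′ f<l = alternate-between (adjacent⇒alternate vv′) (span _) f<l

  -- No vertex of B lies strictly inside the span of a vertex u ≠ x of A:
  -- following a path from it to y, its neighbours would stay inside, but y
  -- occurs only once.
  B-not-inside-A : ∀ {u v} → A u → u ≢ x → WalkAvoiding T x y v y →
    first u < first v → first v < last v → last v < last u → ⊥
  B-not-inside-A a u≢x here _ fy<ly _ = <-irrefl y-single fy<ly
  B-not-inside-A {u} a u≢x (step {v = v′} vv′ _ rest) fu<fv fv<lv lv<lu
    with neighbour-inside vv′ fv<lv
  ... | k , fv<k , k<lv , at
    with meets-inside (cross-noncrossing a (B-walk rest) (λ u≡x,_ → u≢x (proj₁ u≡x,_)))
                      (span v′) at (<-trans fu<fv fv<k) (<-trans k<lv lv<lu)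
  ...   | fu<fv′ , fv′<lv′ , lv′<lu = B-not-inside-A a u≢x rest fu<fv′ fv′<lv′ lv′<lu

  x-before-B : ∀ {v} → WalkAvoiding T x y v y → last x < first v
  x-before-B here = x-before-y (Span.at-last (span x)) (Span.at-first (span y))
  x-before-B {v} walk@(step {v = v′} vv′ _ rest) = by-cases (v ≟ y)
    where
    by-cases : Dec (v ≡ y) → last x < first v
    by-cases (yes refl) = x-before-B here
    by-cases (no v≢y) with cross-noncrossing here (B-walk walk) (λ x≡x,v≡y → v≢y (proj₂ x≡x,v≡y))
    ... | before lx<fv = lx<fv
    ... | surrounds fx<fv fv<lv lv<lx = ⊥-elim (<-irrefl x-single (<-trans fx<fv (<-trans fv<lv lv<lx)))
    ... | inside _ fx<lx _ = ⊥-elim (<-irrefl x-single fx<lx)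
    ... | after lv<fx with neighbour-inside vv′ (twice (B-not-x (B-walk walk)) v≢y)
    ...   | k , _ , k<lv , at =
      ⊥-elim (<-asym (<-≤-trans (x-before-B rest) (proj₁ (span-bounds (span v′) at)))
                     (<-trans k<lv (subst (last v <_) x-single lv<fx)))

  A-before-B : ∀ {u v} → WalkAvoiding T x y u x → WalkAvoiding T x y v y → last u < first v
  A-before-B here b-walk = x-before-B b-walk
  A-before-B {u} {v} walk@(step {v = u′} uu′ _ rest) b-walk = by-cases (u ≟ x)
    where
    by-cases : Dec (u ≡ x) → last u < first v
    by-cases (yes refl) = x-before-B b-walk
    by-cases (no u≢x) with neighbour-inside uu′ (twice u≢x (A-not-y (A-walk walk)))
    ... | k , fu<k , _ , at with ≤-<-trans (proj₂ (span-bounds (span u′) at)) (A-before-B rest b-walk)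
    ...   | k<fv with cross-noncrossing (A-walk walk) (B-walk b-walk) (λ u≡x,_ → u≢x (proj₁ u≡x,_))
    ...     | before lu<fv = lu<fv
    ...     | surrounds fu<fv fv<lv lv<lu = ⊥-elim (B-not-inside-A (A-walk walk) u≢x b-walk fu<fv fv<lv lv<lu)
    ...     | after lv<fu = ⊥-elim (<-asym k<fv (<-trans (≤-<-trans (Span.ordered (span v)) lv<fu) fu<k))
    ...     | inside fv<fu _ _ = ⊥-elim (<-asym k<fv (<-trans fv<fu fu<k))

-- Position i lies in the span of its letter, a vertex of T_{x,xy}; that span
-- ends before the span of the letter at j, a vertex of T_{y,xy}, begins.
lemma2 : ∀ {n} → 2 ≤ n → (T : Graph n) → IsTree T →
    (w : Word n) → MinRepresents w T →
    (x y : Fin n) → x ≢ y → occ x w ≡ 1 → occ y w ≡ 1 →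
    (∀ i j → lookup w i ≡ x → lookup w j ≡ y → toℕ i < toℕ j) →
    ∀ i j → InComponent T x y (lookup w i) → InComponent T y x (lookup w j) →
    toℕ i < toℕ j
lemma2 _ T tree w minimal x y x≢y x-once y-once x-before-y i j a b = begin-strict
  toℕ i               ≤⟨ proj₂ (span-bounds (span (lookup w i)) (At-lookup w i)) ⟩
  last (lookup w i)   <⟨ A-before-B (walk-reverse a) (walk-reverse (walk-swap b)) ⟩
  first (lookup w j)  ≤⟨ proj₁ (span-bounds (span (lookup w j)) (At-lookup w j)) ⟩
  toℕ j               ∎
  where
  open AvoidingWalks {G = T}
  open ≤-Reasoning
  x-before-y′ : ∀ {k l} → At w k x → At w l y → k < l
  x-before-y′ at-x at-y with At⇒lookup at-x | At⇒lookup at-y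
  ... | i′ , refl , w[i′]≡x | j′ , refl , w[j′]≡y = x-before-y i′ j′ w[i′]≡x w[j′]≡y
  open Analysis T tree w minimal x≢y x-once y-once x-before-y′
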